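{- Let $F$ be a 2-CNF formula containing no semicomplete sub-multiset of clauses. Let $Q_1=(U_1,H_1),\dots,Q_p=(U_p,H_p)$ be a collection of pairwise vertex-disjoint induced stars of $G^0$ with centers $x_1,\dots,x_p$, let $U=\bigcup_{i=1}^pU_i$ and $Q=G^0[U]$. Then there is a set $X\subseteq U$ such that $w_X(Q)\ge\sum_{i=1}^p|I_i|$, where $I_i=U_i\setminus\{x_i\}$ for $i=1,\dots,p$.
   Context: A literal is a variable $x$ or its negation $\overline{x}$. A clause is a finite set of literals with no complementary pair; a 2-CNF formula is a finite multiset of clauses each with exactly 2 literals; clause $\{p,q\}$ is written $pq$. Two distinct clauses $Y,Z$ have a conflict if some literal $\ell\in Y$ has $\overline{\ell}\in Z$; a 2-CNF formula is semicomplete if it has exactly 4 clauses and every pair of distinct clauses has a conflict. For a literal $\ell$, $c(\ell)$ is the number of clauses containing $\ell$; $c(\ell\ell')$ the number of occurrences of clause $\ell\ell'$. The auxiliary graph $G=(V,E)$ has $V=\mathrm{var}(F)$ and $xy\in E$ iff some clause $C$ has $\mathrm{var}(C)=\{x,y\}$; weights $w(x)=c(x)-c(\overline{x})$, $w(xy)=c(x\overline{y})+c(\overline{x}y)-c(xy)-c(\overline{x}\,\overline{y})$; $G^0$ is $G$ with all zero-weight edges removed, and $G^0[U]$ is the subgraph of $G^0$ induced by $U$. $G^0[U]$ is an induced star with center $x$ if $x$ is a vertex of $G^0$, $I$ is an independent set of $G^0$ consisting of neighbours of $x$ in $G^0$, and $U=\{x\}\cup I$. For $X\subseteq\mathrm{var}(F)$,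 $F_X$ is obtained from $F$ by replacing $x$ by $\overline{x}$ and $\overline{x}$ by $x$ for each $x\in X$, and $w_X$ denotes the weights computed in $F_X$; for a subgraph $Q=(U,H)$, $w_X(Q)=\sum_{y\in U}w_X(y)+\sum_{yz\in H}w_X(yz)$. -}

module Defs where

open import Data.Nat using (ℕ; _<_) renaming (_≡ᵇ_ to _==_)
open import Data.Bool using (Bool; true; false; not; _∧_; _∨_; if_then_else_)
open import Data.Integer using (ℤ; +_; _+_; _-_; _≤_)
open import Data.Product using (_×_; _,_; proj₁; proj₂; Σ; ∃)
open import Data.Sum using (_⊎_)
open import Data.Fin using (Fin; toℕ)
open import Data.List using (List; []; _∷_; map; foldr; filterᵇ; concatMap; length; lookup)
open import Data.Bool.ListAction using (any)
open import Data.List.Relation.Unary.All using (All)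
open import Data.List.Relation.Unary.Unique.Propositional using (Unique)
open import Data.List.Membership.Propositional using (_∈_)
open import Relation.Nullary using (¬_)
open import Relation.Binary.PropositionalEquality using (_≡_; _≢_)

-- Variables are natural numbers. A literal is (variable , polarity);
-- polarity true = positive literal x, false = negated literal x̄.
Lit : Set
Lit = ℕ × Bool

var : Lit → ℕ
var = proj₁

neg : Lit → Lit
neg (v , b) = (v , not b)

-- A 2-clause {p,q} is stored as an ordered pair (p , q); the order is irrelevant
-- for every notion below.  Well-formedness (2 literals, no complementary pair,
-- i.e. distinct variables) is imposed by the hypothesis WellFormed.
Clause : Set
Clause = Lit × Lit

-- A 2-CNF formula is a finite multiset of clauses, stored as a list.
Formula : Set
Formula = List Clause

WellFormed : Formula → Set
WellFormed F = All (λ C → var (proj₁ C) ≢ var (proj₂ C)) F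

_∈C_ : Lit → Clause → Set
l ∈C (p , q) = (l ≡ p) ⊎ (l ≡ q)

Conflict : Clause → Clause → Set
Conflict Y Z = Σ Lit (λ l → (l ∈C Y) × (neg l ∈C Z))

-- F contains a semicomplete sub-multiset: four distinct occurrences of clauses
-- (positions i<j<k<l) that pairwise conflict.
HasSemicomplete : Formula → Set
HasSemicomplete F =
  Σ (Fin (length F)) λ i → Σ (Fin (length F)) λ j →
  Σ (Fin (length F)) λ k → Σ (Fin (length F)) λ l →
  (toℕ i < toℕ j) × (toℕ j < toℕ k) × (toℕ k < toℕ l) ×
  let A = lookup F i ; B = lookup F j ; C = lookup F k ; D = lookup F l in
  Conflict A B × Conflict A C × Conflict A D ×
  Conflict B C × Conflict B D × Conflict C D

_==L_ : Lit → Lit → Bool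
(v , true)  ==L (u , true)  = v == u
(v , false) ==L (u , false) = v == u
_ ==L _ = false

countᵇ : {A : Set} → (A → Bool) → List A → ℕ
countᵇ p xs = length (filterᵇ p xs)

sumℤ : List ℤ → ℤ
sumℤ = foldr _+_ (+ 0)

cL : Formula → Lit → ℕ
cL F l = countᵇ (λ C → (l ==L proj₁ C) ∨ (l ==L proj₂ C)) F

cC : Formula → Lit → Lit → ℕ
cC F l l' = countᵇ (λ C → ((proj₁ C ==L l) ∧ (proj₂ C ==L l'))
                        ∨ ((proj₁ C ==L l') ∧ (proj₂ C ==L l))) F

pos ngt : ℕ → Lit
pos x = (x , true)
ngt x = (x , false)

wV : Formula → ℕ → ℤ
wV F x = + cL F (pos x) - + cL F (ngt x)

wE : Formula → ℕ → ℕ → ℤ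
wE F x y = (+ cC F (pos x) (ngt y) + + cC F (ngt x) (pos y))
           - + cC F (pos x) (pos y) - + cC F (ngt x) (ngt y)

isZeroℤ : ℤ → Bool
isZeroℤ (+ 0) = true
isZeroℤ _ = false

isVar : Formula → ℕ → Bool
isVar F x = any (λ C → (var (proj₁ C) == x) ∨ (var (proj₂ C) == x)) F

isEdgeG : Formula → ℕ → ℕ → Bool
isEdgeG F x y = any (λ C → ((var (proj₁ C) == x) ∧ (var (proj₂ C) == y))
                         ∨ ((var (proj₁ C) == y) ∧ (var (proj₂ C) == x))) F

isEdge0 : Formula → ℕ → ℕ → Bool
isEdge0 F x y = isEdgeG F x y ∧ not (isZeroℤ (wE F x y))

-- Induced stars.  A star is given by (center x , list I of leaves),
-- U = x ∷ I.  Distinctness of vertices is imposed globally by Unique.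

Star : Set
Star = ℕ × List ℕ

IsInducedStar : Formula → Star → Set
IsInducedStar F (x , I) =
  (isVar F x ≡ true) ×
  All (λ y → isEdge0 F x y ≡ true) I ×
  All (λ y → All (λ z → isEdge0 F y z ≡ false) I) I

starVerts : Star → List ℕ
starVerts (x , I) = x ∷ I

memb : ℕ → List ℕ → Bool
memb v X = any (v ==_) X

flipLit : List ℕ → Lit → Lit
flipLit X (v , b) = if memb v X then (v , not b) else (v , b)

flipF : List ℕ → Formula → Formula
flipF X F = map (λ C → (flipLit X (proj₁ C) , flipLit X (proj₂ C))) F

pairs : {A : Set} → List A → List (A × A)
pairs [] = []
pairs (a ∷ as) = map (a ,_) as Data.List.++ pairs as

-- w_X(Q) for Q = G⁰[U] (edges of G⁰ of F among U; G⁰ of F and of F_X coincide),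
-- weights computed in F_X.  U is assumed duplicate-free.
wXInduced : Formula → List ℕ → List ℕ → ℤ
wXInduced F X U =
  sumℤ (map (wV (flipF X F)) U)
  + sumℤ (map (λ e → wE (flipF X F) (proj₁ e) (proj₂ e))
              (filterᵇ (λ e → isEdge0 F (proj₁ e) (proj₂ e)) (pairs U)))

module Submission where

-- Flipping a variable v (replacing v by v̄ and back) negates w(v) and
-- negates w(vu) for every u that is not flipped as well; it leaves G⁰ unchanged.
-- Hence, writing σ v = true for "v is flipped", the quantity w_X(Q) is the
-- "signed value" of U: the sum of ±w(v) over v ∈ U plus ±w(ab) over the edges
-- ab of G⁰[U], the sign of an edge being negative iff exactly one end is
-- flipped.  For a star S = {x} ∪ I we orient every leaf y so that the edge xy
-- contributes |w(xy)| ≥ 1; the leaves are independent, so the edges inside S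
-- give at least |I|.  The rest of the contribution of S (its vertex weights and
-- its edges to the later stars) changes sign when all of S is flipped, so one
-- of the two orientations of S makes it non-negative.  Going through the stars
-- from the last to the first gives a signing σ with value ≥ Σ|Iᵢ|, and X is the
-- set of flipped vertices of U.
--
-- The argument does not need that F is well formed or free of semicomplete
-- subformulas.

open import Defs
open import Data.Nat as ℕ using (ℕ) renaming (_≡ᵇ_ to _==_)
open import Data.Nat.Properties using (≡ᵇ⇒≡; ≡⇒≡ᵇ; _≟_)
open import Data.Nat.ListAction using (sum)
open import Data.Bool using (Bool; true; false; not; _∧_; _∨_; _xor_; if_then_else_; T)
open import Data.Bool.Properties using (T-≡; not-involutive; not-distribˡ-xor; not-distribʳ-xor)
open import Data.Integer as ℤ using (ℤ; +_; -[1+_]; _+_; _-_; -_; _≤_)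
import Data.Integer.Properties as ℤP
open import Data.Integer.Tactic.RingSolver using (solve-∀)
open import Data.Product using (_×_; _,_; proj₁; proj₂; Σ)
open import Data.Sum using (_⊎_; inj₁; inj₂)
open import Data.Empty using (⊥-elim)
open import Data.List using (List; []; _∷_; map; filterᵇ; length; _++_; concatMap)
open import Data.List.Properties using (map-∘)
open import Data.List.Relation.Unary.All as All using (All; []; _∷_)
import Data.List.Relation.Unary.All.Properties as AllP
import Data.List.Relation.Unary.Any as Any
open import Data.List.Relation.Unary.Any.Properties using (any⁺; any⁻)
open import Data.List.Relation.Unary.AllPairs using (_∷_)
open import Data.List.Relation.Unary.Unique.Propositional using (Unique)
open import Data.List.Membership.Propositional using (_∈_; _∉_)
open import Data.List.Membership.Propositional.Properties using (∈-filter⁺; ∈-filter⁻)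
open import Data.List.Relation.Binary.Subset.Propositional using (_⊆_)
open import Data.List.Relation.Binary.Subset.Propositional.Properties using (filter-⊆)
open import Function using (_∘_; Equivalence)
open import Relation.Nullary using (¬_; yes; no)
open import Relation.Nullary.Decidable using (T?)
open import Relation.Binary.PropositionalEquality

T⇒≡true : ∀ {b} → T b → b ≡ true
T⇒≡true = Equivalence.to T-≡

¬T⇒≡false : ∀ {b} → ¬ T b → b ≡ false
¬T⇒≡false {false} _ = refl
¬T⇒≡false {true} ¬t = ⊥-elim (¬t _)

==-refl : ∀ n → (n == n) ≡ true
==-refl n = T⇒≡true (≡⇒≡ᵇ n n refl)

==-false : ∀ {v u} → v ≢ u → (v == u) ≡ false
==-false {v} {u} v≢u = ¬T⇒≡false (v≢u ∘ ≡ᵇ⇒≡ v u)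

∈⇒memb : ∀ {v L} → v ∈ L → memb v L ≡ true
∈⇒memb {v} v∈L = T⇒≡true (any⁺ (v ==_) (Any.map (≡⇒≡ᵇ v _) v∈L))

memb⇒∈ : ∀ {v} L → T (memb v L) → v ∈ L
memb⇒∈ {v} L t = Any.map (≡ᵇ⇒≡ v _) (any⁻ (v ==_) L t)

∉⇒memb : ∀ {v L} → v ∉ L → memb v L ≡ false
∉⇒memb {L = L} v∉L = ¬T⇒≡false (v∉L ∘ memb⇒∈ L)

memb-filter : ∀ (σ : ℕ → Bool) {v} L → v ∈ L → memb v (filterᵇ σ L) ≡ σ v
memb-filter σ {v} L v∈L with σ v in σv
... | true  = ∈⇒memb (∈-filter⁺ (T? ∘ σ) v∈L (subst T (sym σv) _))
... | false = ∉⇒memb {L = filterᵇ σ L} (λ v∈X → subst T σv (proj₂ (∈-filter⁻ (T? ∘ σ) {xs = L} v∈X)))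

unique-++⁻ : ∀ xs {ys : List ℕ} → Unique (xs ++ ys) → Unique ys × All (λ x → All (x ≢_) ys) xs
unique-++⁻ [] unique = unique , []
unique-++⁻ (x ∷ xs) (x∉ ∷ unique) =
  let (uniqueYs , disjoint) = unique-++⁻ xs unique in uniqueYs , AllP.++⁻ʳ xs x∉ ∷ disjoint

flipLit-xor : ∀ X v b → flipLit X (v , b) ≡ (v , memb v X xor b)
flipLit-xor X v b with memb v X
... | true  = refl
... | false = refl

toggle-==L : ∀ v u m b d → ((v , m xor b) ==L (u , d)) ≡ ((v , b) ==L (u , m xor d))
toggle-==L v u false b d = refl
toggle-==L v u true true true = refl
toggle-==L v u true true false = refl
toggle-==L v u true false true = refl
toggle-==L v u true false false = refl

distinct-==L : ∀ {v u} → v ≢ u → ∀ b d → ((v , b) ==L (u , d)) ≡ false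
distinct-==L v≢u true true = ==-false v≢u
distinct-==L v≢u true false = refl
distinct-==L v≢u false true = refl
distinct-==L v≢u false false = ==-false v≢u

flip-==L : ∀ X a c → (flipLit X a ==L c) ≡ (a ==L flipLit X c)
flip-==L X (v , b) (u , d) rewrite flipLit-xor X v b | flipLit-xor X u d with v ≟ u
... | yes refl = toggle-==L v v (memb v X) b d
... | no v≢u   = trans (distinct-==L v≢u (memb v X xor b) d) (sym (distinct-==L v≢u b (memb u X xor d)))

count-map : ∀ {A B : Set} (p : B → Bool) (q : A → Bool) (f : A → B) →
  (∀ a → p (f a) ≡ q a) → ∀ xs → countᵇ p (map f xs) ≡ countᵇ q xs
count-map p q f pf≡q [] = refl
count-map p q f pf≡q (x ∷ xs) rewrite pf≡q x with q x
... | true  = cong ℕ.suc (count-map p q f pf≡q xs)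
... | false = count-map p q f pf≡q xs

cL-flip : ∀ X F l → cL (flipF X F) l ≡ cL F (flipLit X l)
cL-flip X F l = count-map _ _ _ (λ C → sym (cong₂ _∨_
  (flip-==L X l (proj₁ C)) (flip-==L X l (proj₂ C)))) F

cC-flip : ∀ X F l l' → cC (flipF X F) l l' ≡ cC F (flipLit X l) (flipLit X l')
cC-flip X F l l' = count-map _ _ _ commutes F
  where
  commutes : ∀ C → (((flipLit X (proj₁ C) ==L l) ∧ (flipLit X (proj₂ C) ==L l'))
                  ∨ ((flipLit X (proj₁ C) ==L l') ∧ (flipLit X (proj₂ C) ==L l)))
                 ≡ (((proj₁ C ==L flipLit X l) ∧ (proj₂ C ==L flipLit X l'))
                  ∨ ((proj₁ C ==L flipLit X l') ∧ (proj₂ C ==L flipLit X l)))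
  commutes (p , q) rewrite flip-==L X p l | flip-==L X q l'
                         | flip-==L X p l' | flip-==L X q l = refl

sg : Bool → ℤ → ℤ
sg true z  = - z
sg false z = z

sg-not : ∀ b z → sg (not b) z ≡ - sg b z
sg-not true z  = sym (ℤP.neg-involutive z)
sg-not false z = refl

wV-flip : ∀ X F v → wV (flipF X F) v ≡ sg (memb v X) (wV F v)
wV-flip X F v rewrite cL-flip X F (pos v) | cL-flip X F (ngt v)
                    | flipLit-xor X v true | flipLit-xor X v false with memb v X
... | true  = swap (+ cL F (pos v)) (+ cL F (ngt v))
  where
  swap : ∀ (a b : ℤ) → b - a ≡ - (a - b)
  swap = solve-∀
... | false = refl

wE-flip : ∀ X F x y → wE (flipF X F) x y ≡ sg (memb x X xor memb y X) (wE F x y)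
wE-flip X F x y
  rewrite cC-flip X F (pos x) (ngt y) | cC-flip X F (ngt x) (pos y)
        | cC-flip X F (pos x) (pos y) | cC-flip X F (ngt x) (ngt y)
        | flipLit-xor X x true | flipLit-xor X x false
        | flipLit-xor X y true | flipLit-xor X y false
  with memb x X | memb y X
... | false | false = refl
... | true | true = bothFlipped (+ cC F (ngt x) (pos y)) (+ cC F (pos x) (ngt y))
                                (+ cC F (ngt x) (ngt y)) (+ cC F (pos x) (pos y))
  where
  bothFlipped : ∀ (a b c d : ℤ) → (a + b) - c - d ≡ (b + a) - d - c
  bothFlipped = solve-∀
... | true | false = oneFlipped (+ cC F (ngt x) (ngt y)) (+ cC F (pos x) (pos y))
                                (+ cC F (ngt x) (pos y)) (+ cC F (pos x) (ngt y))
  where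
  oneFlipped : ∀ (a b c d : ℤ) → (a + b) - c - d ≡ - ((d + c) - b - a)
  oneFlipped = solve-∀
... | false | true = oneFlipped (+ cC F (pos x) (pos y)) (+ cC F (ngt x) (ngt y))
                                (+ cC F (pos x) (ngt y)) (+ cC F (ngt x) (pos y))
  where
  oneFlipped : ∀ (a b c d : ℤ) → (a + b) - c - d ≡ - ((c + d) - a - b)
  oneFlipped = solve-∀

sumℤ-++ : ∀ {A : Set} (f : A → ℤ) xs ys →
  sumℤ (map f (xs ++ ys)) ≡ sumℤ (map f xs) + sumℤ (map f ys)
sumℤ-++ f [] ys = sym (ℤP.+-identityˡ _)
sumℤ-++ f (x ∷ xs) ys rewrite sumℤ-++ f xs ys = sym (ℤP.+-assoc (f x) _ _)

sumℤ-cong : ∀ {A : Set} {f g : A → ℤ} {L} → All (λ a → f a ≡ g a) L →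
  sumℤ (map f L) ≡ sumℤ (map g L)
sumℤ-cong [] = refl
sumℤ-cong (fa≡ga ∷ eqs) = cong₂ _+_ fa≡ga (sumℤ-cong eqs)

sumℤ-neg : ∀ {A : Set} {f g : A → ℤ} {L} → All (λ a → f a ≡ - g a) L →
  sumℤ (map f L) ≡ - sumℤ (map g L)
sumℤ-neg [] = refl
sumℤ-neg {g = g} (fa≡-ga ∷ eqs) =
  trans (cong₂ _+_ fa≡-ga (sumℤ-neg eqs)) (sym (ℤP.neg-distrib-+ (g _) _))

sumℤ-zero : ∀ {A : Set} {f : A → ℤ} {L} → All (λ a → f a ≡ + 0) L → sumℤ (map f L) ≡ + 0
sumℤ-zero [] = refl
sumℤ-zero (fa≡0 ∷ eqs) rewrite fa≡0 | sumℤ-zero eqs = refl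

sumℤ-count : ∀ {A : Set} {f : A → ℤ} {L} → All (λ a → + 1 ≤ f a) L → + length L ≤ sumℤ (map f L)
sumℤ-count [] = ℤP.≤-refl
sumℤ-count (1≤fa ∷ bounds) = ℤP.+-mono-≤ 1≤fa (sumℤ-count bounds)

sumℤ-filter : ∀ {A : Set} (p : A → Bool) (f : A → ℤ) L →
  sumℤ (map f (filterᵇ p L)) ≡ sumℤ (map (λ a → if p a then f a else + 0) L)
sumℤ-filter p f [] = refl
sumℤ-filter p f (x ∷ L) with p x
... | true  = cong (λ s → f x + s) (sumℤ-filter p f L)
... | false = trans (sumℤ-filter p f L) (sym (ℤP.+-identityˡ _))

-- A signing marks the flipped vertices.
Signing : Set
Signing = ℕ → Bool

Agree Anti : Signing → Signing → List ℕ → Set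
Agree σ τ L = All (λ v → σ v ≡ τ v) L
Anti σ τ L = All (λ v → σ v ≡ not (τ v)) L

module Signed (wv : ℕ → ℤ) (we : ℕ → ℕ → ℤ) (edge : ℕ → ℕ → Bool) where

  vertexTerm : Signing → ℕ → ℤ
  vertexTerm σ v = sg (σ v) (wv v)

  edgeTerm : Signing → ℕ → ℕ → ℤ
  edgeTerm σ a b = if edge a b then sg (σ a xor σ b) (we a b) else + 0

  vertexSum : Signing → List ℕ → ℤ
  vertexSum σ L = sumℤ (map (vertexTerm σ) L)

  rowSum : Signing → ℕ → List ℕ → ℤ
  rowSum σ a L = sumℤ (map (edgeTerm σ a) L)

  pairSum : Signing → List ℕ → ℤ
  pairSum σ [] = + 0
  pairSum σ (a ∷ L) = rowSum σ a L + pairSum σ L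

  crossSum : Signing → List ℕ → List ℕ → ℤ
  crossSum σ A B = sumℤ (map (λ a → rowSum σ a B) A)

  value : Signing → List ℕ → ℤ
  value σ L = vertexSum σ L + pairSum σ L

  outer : Signing → List ℕ → List ℕ → ℤ
  outer σ A B = vertexSum σ A + crossSum σ A B

  pairSum-++ : ∀ σ A B → pairSum σ (A ++ B) ≡ pairSum σ A + pairSum σ B + crossSum σ A B
  pairSum-++ σ [] B = sym (trans (ℤP.+-identityʳ _) (ℤP.+-identityˡ _))
  pairSum-++ σ (a ∷ A) B rewrite sumℤ-++ (edgeTerm σ a) A B | pairSum-++ σ A B =
    regroup (rowSum σ a A) (rowSum σ a B) (pairSum σ A) (pairSum σ B) (crossSum σ A B)
    where
    regroup : ∀ (r₁ r₂ p₁ p₂ c : ℤ) → (r₁ + r₂) + (p₁ + p₂ + c) ≡ (r₁ + p₁) + p₂ + (r₂ + c)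
    regroup = solve-∀

  value-++ : ∀ σ A B → value σ (A ++ B) ≡ (outer σ A B + pairSum σ A) + value σ B
  value-++ σ A B rewrite sumℤ-++ (vertexTerm σ) A B | pairSum-++ σ A B =
    regroup (vertexSum σ A) (vertexSum σ B) (pairSum σ A) (pairSum σ B) (crossSum σ A B)
    where
    regroup : ∀ (v₁ v₂ p₁ p₂ c : ℤ) → (v₁ + v₂) + (p₁ + p₂ + c) ≡ ((v₁ + c) + p₁) + (v₂ + p₂)
    regroup = solve-∀

  value-agree : ∀ σ τ L → Agree σ τ L → value σ L ≡ value τ L
  value-agree σ τ L ag = cong₂ _+_ (sumℤ-cong (All.map (cong (λ s → sg s _)) ag)) (inner L ag)
    where
    inner : ∀ L → Agree σ τ L → pairSum σ L ≡ pairSum τ L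
    inner [] _ = refl
    inner (a ∷ L) (σa≡τa ∷ ag) = cong₂ _+_
      (sumℤ-cong (All.map (λ σb≡τb → cong (λ s → if edge a _ then sg s (we a _) else + 0)
                                          (cong₂ _xor_ σa≡τa σb≡τb)) ag))
      (inner L ag)

  pairSum-pairs : ∀ σ U → sumℤ (map (λ q → edgeTerm σ (proj₁ q) (proj₂ q)) (pairs U)) ≡ pairSum σ U
  pairSum-pairs σ [] = refl
  pairSum-pairs σ (a ∷ L) = trans (sumℤ-++ _ (map (a ,_) L) (pairs L))
    (cong₂ _+_ (cong sumℤ (sym (map-∘ L))) (pairSum-pairs σ L))

  edgeTerm-anti : ∀ σ τ {a b} → σ a ≡ not (τ a) → σ b ≡ τ b → edgeTerm σ a b ≡ - edgeTerm τ a b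
  edgeTerm-anti σ τ {a} {b} σa σb rewrite σa | σb with edge a b
  ... | true  = trans (cong (λ s → sg s (we a b)) (sym (not-distribˡ-xor (τ a) (τ b))))
                      (sg-not (τ a xor τ b) (we a b))
  ... | false = refl

  edgeTerm-anti₂ : ∀ σ τ {a b} → σ a ≡ not (τ a) → σ b ≡ not (τ b) → edgeTerm σ a b ≡ edgeTerm τ a b
  edgeTerm-anti₂ σ τ {a} {b} σa σb rewrite σa | σb =
    cong (λ s → if edge a b then sg s (we a b) else + 0) notnot
    where
    notnot : (not (τ a) xor not (τ b)) ≡ (τ a xor τ b)
    notnot = trans (sym (not-distribˡ-xor (τ a) (not (τ b))))
                   (trans (cong not (sym (not-distribʳ-xor (τ a) (τ b)))) (not-involutive _))

  outer-anti : ∀ σ τ S U → Anti σ τ S → Agree σ τ U → outer σ S U ≡ - outer τ S U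
  outer-anti σ τ S U anS agU = trans
    (cong₂ _+_ (sumℤ-neg (All.map (λ {v} σv → trans (cong (λ s → sg s (wv v)) σv) (sg-not (τ v) (wv v))) anS))
               (sumℤ-neg (All.map (λ σa → sumℤ-neg (All.map (edgeTerm-anti σ τ σa) agU)) anS)))
    (sym (ℤP.neg-distrib-+ (vertexSum τ S) (crossSum τ S U)))

  pairSum-anti : ∀ σ τ S → Anti σ τ S → pairSum σ S ≡ pairSum τ S
  pairSum-anti σ τ [] _ = refl
  pairSum-anti σ τ (a ∷ S) (σa ∷ anS) =
    cong₂ _+_ (sumℤ-cong (All.map (edgeTerm-anti₂ σ τ σa) anS)) (pairSum-anti σ τ S anS)

  nonneg-side : ∀ σ₁ σ₂ S U → Anti σ₂ σ₁ S → Agree σ₂ σ₁ U →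
    (+ 0 ≤ outer σ₁ S U) ⊎ (+ 0 ≤ outer σ₂ S U)
  nonneg-side σ₁ σ₂ S U anS agU with ℤP.≤-total (+ 0) (outer σ₁ S U)
  ... | inj₁ nonneg = inj₁ nonneg
  ... | inj₂ nonpos = inj₂ (subst (+ 0 ≤_) (sym (outer-anti σ₂ σ₁ S U anS agU)) (ℤP.neg-mono-≤ nonpos))

  pairSum-independent : ∀ σ I → All (λ y → All (λ z → edge y z ≡ false) I) I → pairSum σ I ≡ + 0
  pairSum-independent σ [] _ = refl
  pairSum-independent σ (y ∷ I) (noEdges ∷ indep) = cong₂ _+_
    (sumℤ-zero (All.map (λ e≡f → cong (λ c → if c then _ else + 0) e≡f) (All.tail noEdges)))
    (pairSum-independent σ I (All.map All.tail indep))

  isNeg : ℤ → Bool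
  isNeg (+ _)    = false
  isNeg -[1+ _ ] = true

  sg-isNeg : ∀ w → isZeroℤ w ≡ false → + 1 ≤ sg (isNeg w) w
  sg-isNeg (+ ℕ.zero) ()
  sg-isNeg (+ ℕ.suc n) _ = ℤ.+≤+ (ℕ.s≤s ℕ.z≤n)
  sg-isNeg -[1+ n ] _    = ℤ.+≤+ (ℕ.s≤s ℕ.z≤n)

  pairSum-star : ∀ σ x I → σ x ≡ false →
    All (λ y → (edge x y ≡ true) × (isZeroℤ (we x y) ≡ false) × (σ y ≡ isNeg (we x y))) I →
    All (λ y → All (λ z → edge y z ≡ false) I) I →
    + length I ≤ pairSum σ (x ∷ I)
  pairSum-star σ x I σx leaves indep
    rewrite pairSum-independent σ I indep | ℤP.+-identityʳ (rowSum σ x I) =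
    sumℤ-count (All.map edgeAtLeastOne leaves)
    where
    edgeAtLeastOne : ∀ {y} → (edge x y ≡ true) × (isZeroℤ (we x y) ≡ false) × (σ y ≡ isNeg (we x y)) →
      + 1 ≤ edgeTerm σ x y
    edgeAtLeastOne {y} (isEdge , nonzero , σy) rewrite isEdge | σx | σy = sg-isNeg (we x y) nonzero

module Stars (wv : ℕ → ℤ) (we : ℕ → ℕ → ℤ) (edge : ℕ → ℕ → Bool)
  (nonzero : ∀ a b → edge a b ≡ true → isZeroℤ (we a b) ≡ false) where
  open Signed wv we edge

  StarOK : Star → Set
  StarOK (x , I) = All (λ y → edge x y ≡ true) I × All (λ y → All (λ z → edge y z ≡ false) I) I

  leaves : List Star → ℕ
  leaves stars = sum (map (λ s → length (proj₂ s)) stars)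

  override : List ℕ → Signing → Signing → Signing
  override S τ σ v = if memb v S then τ v else σ v

  override-in : ∀ S τ σ {v} → v ∈ S → override S τ σ v ≡ τ v
  override-in S τ σ {v} v∈S = cong (λ b → if b then τ v else σ v) (∈⇒memb v∈S)

  override-out : ∀ S τ σ {v} → v ∉ S → override S τ σ v ≡ σ v
  override-out S τ σ {v} v∉S = cong (λ b → if b then τ v else σ v) (∉⇒memb v∉S)

  starSigning : ℕ → Signing
  starSigning x v = if v == x then false else isNeg (we x v)

  orient-star : ∀ σ x I → StarOK (x , I) → All (x ≢_) I → Agree σ (starSigning x) (x ∷ I) →
    + length I ≤ pairSum σ (x ∷ I)
  orient-star σ x I (edges , indep) x∉I (σx ∷ σI) =
    pairSum-star σ x I (trans σx (cong (λ b → if b then false else isNeg (we x x)) (==-refl x)))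
      (All.zipWith leafFacts (edges , All.zip (x∉I , σI))) indep
    where
    leafFacts : ∀ {y} → edge x y ≡ true × (x ≢ y × σ y ≡ starSigning x y) →
      (edge x y ≡ true) × (isZeroℤ (we x y) ≡ false) × (σ y ≡ isNeg (we x y))
    leafFacts {y} (isEdge , x≢y , σy) = isEdge , nonzero x y isEdge ,
      trans σy (cong (λ b → if b then false else isNeg (we x y)) (==-false (x≢y ∘ sym)))

  extend : ∀ x I U σ' → StarOK (x , I) → All (x ≢_) I → All (λ s → All (s ≢_) U) (x ∷ I) →
    Σ Signing λ σ → Agree σ σ' U × (+ length I ≤ outer σ (x ∷ I) U + pairSum σ (x ∷ I))
  extend x I U σ' ok x∉I disjoint = choose (nonneg-side σ₁ σ₂ S U anti agree)
    where
    S = x ∷ I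
    τ = starSigning x
    σ₁ σ₂ : Signing
    σ₁ = override S τ σ'
    σ₂ = override S (not ∘ τ) σ'
    outside : ∀ {u} → u ∈ U → u ∉ S
    outside u∈U u∈S = All.lookup (All.lookup disjoint u∈S) u∈U refl
    agree₁ : Agree σ₁ σ' U
    agree₁ = All.tabulate (override-out S τ σ' ∘ outside)
    agree₂ : Agree σ₂ σ' U
    agree₂ = All.tabulate (override-out S (not ∘ τ) σ' ∘ outside)
    agree : Agree σ₂ σ₁ U
    agree = All.tabulate (λ u∈U → trans (All.lookup agree₂ u∈U) (sym (All.lookup agree₁ u∈U)))
    anti : Anti σ₂ σ₁ S
    anti = All.tabulate (λ v∈S → trans (override-in S (not ∘ τ) σ' v∈S)
                                       (cong not (sym (override-in S τ σ' v∈S))))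
    inner₁ : + length I ≤ pairSum σ₁ S
    inner₁ = orient-star σ₁ x I ok x∉I (All.tabulate (override-in S τ σ'))
    nonneg+ : ∀ {a b c} → + 0 ≤ a → b ≤ c → b ≤ a + c
    nonneg+ {b = b} 0≤a b≤c = subst (_≤ _) (ℤP.+-identityˡ b) (ℤP.+-mono-≤ 0≤a b≤c)
    choose : (+ 0 ≤ outer σ₁ S U) ⊎ (+ 0 ≤ outer σ₂ S U) →
      Σ Signing λ σ → Agree σ σ' U × (+ length I ≤ outer σ S U + pairSum σ S)
    choose (inj₁ nonneg) = σ₁ , agree₁ , nonneg+ nonneg inner₁
    choose (inj₂ nonneg) = σ₂ , agree₂ ,
      nonneg+ nonneg (subst (+ length I ≤_) (sym (pairSum-anti σ₂ σ₁ S anti)) inner₁)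

  signStars : ∀ stars → All StarOK stars → Unique (concatMap starVerts stars) →
    Σ Signing λ σ → + leaves stars ≤ value σ (concatMap starVerts stars)
  signStars [] [] _ = (λ _ → false) , ℤP.≤-refl
  signStars ((x , I) ∷ rest) (ok ∷ oks) unique@(x∉ ∷ _) =
    σ , subst (+ (length I ℕ.+ leaves rest) ≤_) (sym split) (ℤP.+-mono-≤ starBound restBound)
    where
    U = concatMap starVerts rest
    S = x ∷ I
    parts = unique-++⁻ S unique
    later = signStars rest oks (proj₁ parts)
    σ' = proj₁ later
    restBound = proj₂ later
    extended = extend x I U σ' ok (AllP.++⁻ˡ I x∉) (proj₂ parts)
    σ = proj₁ extended
    starBound = proj₂ (proj₂ extended)
    split : value σ (S ++ U) ≡ (outer σ S U + pairSum σ S) + value σ' U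
    split = trans (value-++ σ S U)
      (cong (λ r → (outer σ S U + pairSum σ S) + r) (value-agree σ σ' U (proj₁ (proj₂ extended))))

wXInduced-value : ∀ F X U → wXInduced F X U ≡ Signed.value (wV F) (wE F) (isEdge0 F) (λ v → memb v X) U
wXInduced-value F X U = cong₂ _+_
  (sumℤ-cong (All.universal (wV-flip X F) U))
  (trans (sumℤ-filter _ _ (pairs U))
    (trans (sumℤ-cong (All.universal edgeFlip (pairs U))) (pairSum-pairs (λ v → memb v X) U)))
  where
  open Signed (wV F) (wE F) (isEdge0 F)
  edgeFlip : ∀ q → (if isEdge0 F (proj₁ q) (proj₂ q) then wE (flipF X F) (proj₁ q) (proj₂ q) else + 0)
                   ≡ edgeTerm (λ v → memb v X) (proj₁ q) (proj₂ q)
  edgeFlip (a , b) rewrite wE-flip X F a b = refl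

isEdge0-nonzero : ∀ F a b → isEdge0 F a b ≡ true → isZeroℤ (wE F a b) ≡ false
isEdge0-nonzero F a b isEdge with isEdgeG F a b | isZeroℤ (wE F a b)
isEdge0-nonzero F a b () | false | _
isEdge0-nonzero F a b () | true | true
... | true | false = refl

lemma5p9 : (F : Formula) → WellFormed F → ¬ HasSemicomplete F →
    (stars : List Star) → All (IsInducedStar F) stars →
    Unique (concatMap starVerts stars) →
    Σ (List ℕ) (λ X → (X ⊆ concatMap starVerts stars) ×
      (+ sum (map (λ s → length (proj₂ s)) stars)
        ≤ wXInduced F X (concatMap starVerts stars)))
lemma5p9 F _ _ stars induced unique =
  X , filter-⊆ (T? ∘ σ) U , subst (+ leaves stars ≤_) (sym wX≡value) bound
  where
  open Signed (wV F) (wE F) (isEdge0 F)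
  open Stars (wV F) (wE F) (isEdge0 F) (isEdge0-nonzero F)
  U = concatMap starVerts stars
  signing = signStars stars (All.map (λ (_ , starOK) → starOK) induced) unique
  σ = proj₁ signing
  bound = proj₂ signing
  X = filterᵇ σ U
  wX≡value : wXInduced F X U ≡ value σ U
  wX≡value = trans (wXInduced-value F X U) (value-agree _ σ U (All.tabulate (memb-filter σ U)))
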